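{- Let $d\geq 3$, $i\geq 0$, $I=[i,i+d-1]$ and $J=\{0,j_2,\ldots,j_{d-1}\}$ with $0<j_2<\cdots<j_{d-1}$, and suppose $J\leq I\setminus\{i+d-1\}$. Write $J'=\{j_2-1,\ldots,j_{d-1}-1\}$. If $2\leq r\leq d-1$, then \[ b^{I\setminus\{i+r-1\}}_J=b^{[i,i+d-2]\setminus\{i+r-1\}}_{J'}+b^{[i,i+d-2]\setminus\{i+r-2\}}_{J'}. \] If $r=1$ or $r=d$, then \[ b^{I\setminus\{i\}}_J=b^{[i+1,i+d-2]}_{J'}\quad\text{and}\quad b^{I\setminus\{i+d-1\}}_J=b^{[i,i+d-3]}_{J'}. \]
   Context: For integers $p,q\geq 0$, $b_{p,q}=\binom{p}{q}$, with $b_{p,q}=0$ if $q>p$. For $k\leq l$, $[k,l]=\{k,\ldots,l\}$. For finite sets $I=\{i_1<\cdots<i_m\}$, $J=\{j_1<\cdots<j_m\}$ of non-negative integers, $b^I_J$ is the determinant of the $m\times m$ matrix with $(r,s)$ entry $b_{i_r,j_s}$, and $J\leq I$ means $j_k\leq i_k$ for all $k$. -}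

module Defs where

open import Data.Nat as ℕ using (ℕ; zero; suc; _+_; _<ᵇ_)
open import Data.Nat.Combinatorics using (_C_)
open import Data.Integer as ℤ using (ℤ; +_)
open import Data.Fin as Fin using (Fin; zero; suc; toℕ; punchIn)
open import Data.Vec using (Vec; lookup; tabulate)
open import Data.Bool using (if_then_else_)

sgn : ℕ → ℤ
sgn zero = + 1
sgn (suc k) = ℤ.- sgn k

ΣFin : (m : ℕ) → (Fin m → ℤ) → ℤ
ΣFin zero f = + 0
ΣFin (suc m) f = f zero ℤ.+ ΣFin m (λ k → f (suc k))

det : (m : ℕ) → (Fin m → Fin m → ℤ) → ℤ
det zero A = + 1
det (suc m) A =
  ΣFin (suc m) (λ k → sgn (toℕ k) ℤ.* (A zero k ℤ.* det m (λ r c → A (suc r) (punchIn k c))))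

b : ℕ → ℕ → ℤ
b p q = + (p C q)

-- b^I_J for I = {i_1<...<i_m}, J = {j_1<...<j_m} given as increasing vectors
bMinor : {m : ℕ} → Vec ℕ m → Vec ℕ m → ℤ
bMinor {m} I J = det m (λ r s → b (lookup I r) (lookup J s))

StrictlyIncreasing : {m : ℕ} → Vec ℕ m → Set
StrictlyIncreasing {m} v = ∀ (a c : Fin m) → a Fin.< c → lookup v a ℕ.< lookup v c

_≼_ : {m : ℕ} → Vec ℕ m → Vec ℕ m → Set
_≼_ {m} J I = ∀ (k : Fin m) → lookup J k ℕ.≤ lookup I k

interval : ℕ → (m : ℕ) → Vec ℕ m
interval i m = tabulate (λ k → i + toℕ k)

-- [i, i+m] \ {i+r-1}  (meaningful for 1 ≤ r ≤ m+1), an increasing vector of length m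
intervalWithout : ℕ → (m : ℕ) → ℕ → Vec ℕ m
intervalWithout i m r = tabulate (λ k → if suc (toℕ k) <ᵇ r then i + toℕ k else i + suc (toℕ k))

-- Since b_{p,0} = 1, the matrix of b^I_{0∷J} has a first column of ones.  Replacing every row
-- but the first by its difference with the row above and expanding along that column leaves the
-- determinant of the consecutive differences b_{I_{k+1},j} − b_{I_k,j}, which by Pascal's rule
-- equal b_{I_k,j−1} when I_{k+1} = I_k + 1 and b_{I_k,j−1} + b_{I_k+1,j−1} when I_{k+1} = I_k + 2.
-- For r = 1 and r = d the set I ∖ {i+r−1} is an interval, so only the first case occurs; for
-- 2 ≤ r ≤ d−1 there is exactly one gap of 2, and linearity of the determinant in that row splits
-- it into the two minors on the right.
--
-- With the determinant defined by Laplace expansion along the first row, linearity in a row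
-- follows by induction, and a matrix with two equal first rows has determinant zero because the
-- double expansion along those rows is a sum over ordered pairs of distinct columns that is
-- antisymmetric in the pair.

{-# OPTIONS --safe #-}
module Submission where

open import Defs
open import Data.Nat using (ℕ; zero; suc; _+_; _≤_; _<_; _∸_; _<ᵇ_; z≤n; s≤s; s≤s⁻¹)
import Data.Nat.Properties as ℕ
open import Data.Nat.Combinatorics using (nCk+nC[k+1]≡[n+1]C[k+1])
open import Data.Integer using (ℤ; +_; -[1+_]; 0ℤ; 1ℤ; -_; _-_; _*_) renaming (_+_ to _+ℤ_)
import Data.Integer.Properties as ℤ
open import Data.Integer.Tactic.RingSolver using (solve-∀)
open import Data.Fin using (Fin; zero; suc; toℕ; fromℕ<; punchIn; punchOut; inject₁; _≟_)
open import Data.Fin.Properties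
  using (punchInᵢ≢i; punchIn-punchOut; suc-injective; toℕ-injective; toℕ-inject₁; toℕ-fromℕ<; toℕ<n)
open import Data.Vec using (Vec; _∷_; map; lookup)
open import Data.Vec.Properties using (lookup∘tabulate; lookup-map; tabulate-cong)
open import Data.Bool using (true; false; if_then_else_)
open import Data.Unit using (tt)
open import Data.Product using (_×_; _,_)
open import Function using (_∘_)
open import Relation.Nullary using (does; yes; no)
open import Relation.Nullary.Decidable using (dec-true; dec-false)
open import Relation.Nullary.Negation using (contradiction)
open import Relation.Binary.Definitions using (tri<; tri≈; tri>)
open import Relation.Binary.PropositionalEquality
  using (_≡_; _≢_; refl; sym; trans; cong; cong₂; module ≡-Reasoning)
open import Algebra.Properties.Semiring.Sum ℤ.+-*-semiring
  using (sum; sum-cong-≗; sum-replicate-zero; sum-remove; ∑-distrib-+; ∑-comm; *-distribˡ-sum)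

open ≡-Reasoning

sum-zero : ∀ {n} {f : Fin n → ℤ} → (∀ k → f k ≡ 0ℤ) → sum f ≡ 0ℤ
sum-zero {n} f≗0 = trans (sum-cong-≗ f≗0) (sum-replicate-zero n)

i+i≡0⇒i≡0 : ∀ {i} → i +ℤ i ≡ 0ℤ → i ≡ 0ℤ
i+i≡0⇒i≡0 {+ zero}    _  = refl
i+i≡0⇒i≡0 {+ suc _}   ()
i+i≡0⇒i≡0 { -[1+ _ ]} ()

∑∑-antisym : ∀ {n} (H : Fin n → Fin n → ℤ) → (∀ k l → H l k ≡ - H k l) →
  sum (λ k → sum (H k)) ≡ 0ℤ
∑∑-antisym H antisym = i+i≡0⇒i≡0 (begin
  S +ℤ S                                         ≡⟨ cong (S +ℤ_) (∑-comm H) ⟩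
  S +ℤ sum (λ k → sum (λ l → H l k))             ≡⟨ ∑-distrib-+ (λ k → sum (H k)) _ ⟨
  sum (λ k → sum (H k) +ℤ sum (λ l → H l k))     ≡⟨ sum-cong-≗ (λ k → ∑-distrib-+ (H k) _) ⟨
  sum (λ k → sum (λ l → H k l +ℤ H l k))         ≡⟨ sum-zero (λ k → sum-zero (λ l → cancel k l)) ⟩
  0ℤ                                             ∎)
  where
  S : ℤ
  S = sum (λ k → sum (H k))
  cancel : ∀ k l → H k l +ℤ H l k ≡ 0ℤ
  cancel k l = trans (cong (H k l +ℤ_) (antisym k l)) (ℤ.+-inverseʳ (H k l))

∑-offDiagonal-antisym : ∀ {n} (T : Fin (suc n) → Fin (suc n) → ℤ) →
  (∀ {k l} → k ≢ l → T l k ≡ - T k l) →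
  sum (λ k → sum (λ l → T k (punchIn k l))) ≡ 0ℤ
∑-offDiagonal-antisym {n} T antisym = trans (sum-cong-≗ row) (∑∑-antisym H H-antisym)
  where
  H : Fin (suc n) → Fin (suc n) → ℤ
  H k l = if does (k ≟ l) then 0ℤ else T k l
  H-diag : ∀ k → H k k ≡ 0ℤ
  H-diag k rewrite dec-true (k ≟ k) refl = refl
  H-off : ∀ {k l} → k ≢ l → H k l ≡ T k l
  H-off {k} {l} k≢l rewrite dec-false (k ≟ l) k≢l = refl
  H-antisym : ∀ k l → H l k ≡ - H k l
  H-antisym k l with k ≟ l
  ... | yes refl = H-diag k
  ... | no k≢l   = trans (H-off (k≢l ∘ sym)) (antisym k≢l)
  row : ∀ k → sum (λ l → T k (punchIn k l)) ≡ sum (H k)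
  row k = begin
    sum (λ l → T k (punchIn k l))             ≡⟨ sum-cong-≗ (λ l → H-off (punchInᵢ≢i k l ∘ sym)) ⟨
    sum (λ l → H k (punchIn k l))             ≡⟨ ℤ.+-identityˡ _ ⟨
    0ℤ +ℤ sum (λ l → H k (punchIn k l))      ≡⟨ cong (_+ℤ sum (λ l → H k (punchIn k l))) (H-diag k) ⟨
    H k k +ℤ sum (λ l → H k (punchIn k l))   ≡⟨ sum-remove (H k) ⟨
    sum (H k)                                 ∎

-- The position of j once i is removed; junk when j ≡ i.
punchOut′ : ∀ {m} → Fin (suc (suc m)) → Fin (suc (suc m)) → Fin (suc m)
punchOut′         zero    zero    = zero
punchOut′         zero    (suc j) = j
punchOut′         (suc i) zero    = zero
punchOut′ {zero}  (suc i) (suc j) = zero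
punchOut′ {suc m} (suc i) (suc j) = suc (punchOut′ i j)

punchOut′-punchIn : ∀ {m} i (j : Fin (suc m)) → punchOut′ i (punchIn i j) ≡ j
punchOut′-punchIn         zero    j       = refl
punchOut′-punchIn         (suc i) zero    = refl
punchOut′-punchIn {suc m} (suc i) (suc j) = cong suc (punchOut′-punchIn i j)

punchIn-punchOut′-comm : ∀ {m} {i j : Fin (suc (suc m))} → i ≢ j → ∀ c →
  punchIn i (punchIn (punchOut′ i j) c) ≡ punchIn j (punchIn (punchOut′ j i) c)
punchIn-punchOut′-comm         {i = zero}  {zero}  0≢0 c = contradiction refl 0≢0
punchIn-punchOut′-comm         {i = zero}  {suc j} _   c = refl
punchIn-punchOut′-comm         {i = suc i} {zero}  _   c = refl
punchIn-punchOut′-comm {zero}  {i = suc zero} {suc zero} 1≢1 c = contradiction refl 1≢1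
punchIn-punchOut′-comm {suc m} {i = suc i} {suc j} _   zero    = refl
punchIn-punchOut′-comm {suc m} {i = suc i} {suc j} i≢j (suc c) =
  cong suc (punchIn-punchOut′-comm (i≢j ∘ cong suc) c)

sgn-punchOut′ : ∀ {m} {i j : Fin (suc (suc m))} → i ≢ j →
  sgn (toℕ j) * sgn (toℕ (punchOut′ j i)) ≡ - (sgn (toℕ i) * sgn (toℕ (punchOut′ i j)))
sgn-punchOut′         {i = zero}  {zero}  0≢0 = contradiction refl 0≢0
sgn-punchOut′         {i = zero}  {suc j} _   = lemma (sgn (toℕ j))
  where
  lemma : ∀ x → - x * 1ℤ ≡ - (1ℤ * x)
  lemma = solve-∀
sgn-punchOut′         {i = suc i} {zero}  _   = lemma (sgn (toℕ i))
  where
  lemma : ∀ x → 1ℤ * x ≡ - (- x * 1ℤ)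
  lemma = solve-∀
sgn-punchOut′ {zero}  {i = suc zero} {suc zero} 1≢1 = contradiction refl 1≢1
sgn-punchOut′ {suc m} {i = suc i} {suc j} i≢j = begin
  - sgn (toℕ j) * - sgn (toℕ (punchOut′ j i))   ≡⟨ neg-cancel (sgn (toℕ j)) _ ⟩
  sgn (toℕ j) * sgn (toℕ (punchOut′ j i))       ≡⟨ sgn-punchOut′ (i≢j ∘ cong suc) ⟩
  - (sgn (toℕ i) * sgn (toℕ (punchOut′ i j)))   ≡⟨ cong -_ (neg-cancel (sgn (toℕ i)) _) ⟨
  - (- sgn (toℕ i) * - sgn (toℕ (punchOut′ i j))) ∎
  where
  neg-cancel : ∀ x y → - x * - y ≡ x * y
  neg-cancel = solve-∀

Matrix : ℕ → Set
Matrix m = Fin m → Fin m → ℤ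

minor : ∀ {m} → Matrix (suc m) → Fin (suc m) → Matrix m
minor A k r c = A (suc r) (punchIn k c)

laplaceTerm : ∀ {m} → Matrix (suc m) → Fin (suc m) → ℤ
laplaceTerm {m} A k = sgn (toℕ k) * (A zero k * det m (minor A k))

ΣFin≡sum : ∀ m (f : Fin m → ℤ) → ΣFin m f ≡ sum f
ΣFin≡sum zero    f = refl
ΣFin≡sum (suc m) f = cong (f zero +ℤ_) (ΣFin≡sum m (λ k → f (suc k)))

det-expand : ∀ m (A : Matrix (suc m)) → det (suc m) A ≡ sum (laplaceTerm A)
det-expand m A = ΣFin≡sum (suc m) (laplaceTerm A)

det-cong-minors : ∀ m {A B : Matrix (suc m)} →
  (∀ c → A zero c ≡ B zero c) → (∀ k → det m (minor A k) ≡ det m (minor B k)) →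
  det (suc m) A ≡ det (suc m) B
det-cong-minors m {A} {B} row₀ minors = begin
  det (suc m) A          ≡⟨ det-expand m A ⟩
  sum (laplaceTerm A)    ≡⟨ sum-cong-≗ (λ k → cong₂ (λ a d → sgn (toℕ k) * (a * d)) (row₀ k) (minors k)) ⟩
  sum (laplaceTerm B)    ≡⟨ det-expand m B ⟨
  det (suc m) B          ∎

det-cong : ∀ m {A B : Matrix m} → (∀ r c → A r c ≡ B r c) → det m A ≡ det m B
det-cong zero    _   = refl
det-cong (suc m) {A} {B} A≗B =
  det-cong-minors m {A} {B} (A≗B zero) (λ k → det-cong m (λ r c → A≗B (suc r) (punchIn k c)))

laplaceTerm-entry≡0 : ∀ {m} (A : Matrix (suc m)) k → A zero k ≡ 0ℤ → laplaceTerm A k ≡ 0ℤ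
laplaceTerm-entry≡0 {m} A k a≡0 = begin
  sgn (toℕ k) * (A zero k * det m (minor A k))   ≡⟨ cong (λ a → sgn (toℕ k) * (a * det m (minor A k))) a≡0 ⟩
  sgn (toℕ k) * (0ℤ * det m (minor A k))         ≡⟨ cong (sgn (toℕ k) *_) (ℤ.*-zeroˡ (det m (minor A k))) ⟩
  sgn (toℕ k) * 0ℤ                               ≡⟨ ℤ.*-zeroʳ (sgn (toℕ k)) ⟩
  0ℤ                                             ∎

laplaceTerm-minor≡0 : ∀ {m} (A : Matrix (suc m)) k → det m (minor A k) ≡ 0ℤ → laplaceTerm A k ≡ 0ℤ
laplaceTerm-minor≡0 {m} A k d≡0 = begin
  sgn (toℕ k) * (A zero k * det m (minor A k))   ≡⟨ cong (λ d → sgn (toℕ k) * (A zero k * d)) d≡0 ⟩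
  sgn (toℕ k) * (A zero k * 0ℤ)                  ≡⟨ cong (sgn (toℕ k) *_) (ℤ.*-zeroʳ (A zero k)) ⟩
  sgn (toℕ k) * 0ℤ                               ≡⟨ ℤ.*-zeroʳ (sgn (toℕ k)) ⟩
  0ℤ                                             ∎

det-termwise-+ : ∀ m {A B C : Matrix (suc m)} →
  (∀ k → laplaceTerm A k ≡ laplaceTerm B k +ℤ laplaceTerm C k) →
  det (suc m) A ≡ det (suc m) B +ℤ det (suc m) C
det-termwise-+ m {A} {B} {C} A≗B+C = begin
  det (suc m) A                                    ≡⟨ det-expand m A ⟩
  sum (laplaceTerm A)                              ≡⟨ sum-cong-≗ A≗B+C ⟩
  sum (λ k → laplaceTerm B k +ℤ laplaceTerm C k)   ≡⟨ ∑-distrib-+ (laplaceTerm B) (laplaceTerm C) ⟩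
  sum (laplaceTerm B) +ℤ sum (laplaceTerm C)       ≡⟨ cong₂ _+ℤ_ (det-expand m B) (det-expand m C) ⟨
  det (suc m) B +ℤ det (suc m) C                   ∎

det-linear : ∀ m (t : Fin m) {A B C : Matrix m} →
  (∀ {r} → r ≢ t → ∀ c → A r c ≡ B r c) →
  (∀ {r} → r ≢ t → ∀ c → A r c ≡ C r c) →
  (∀ c → A t c ≡ B t c +ℤ C t c) →
  det m A ≡ det m B +ℤ det m C
det-linear (suc m) zero {A} {B} {C} A≈B A≈C split = det-termwise-+ m {A} {B} {C} term
  where
  distrib : ∀ s b c d → s * ((b +ℤ c) * d) ≡ s * (b * d) +ℤ s * (c * d)
  distrib = solve-∀
  term : ∀ k → laplaceTerm A k ≡ laplaceTerm B k +ℤ laplaceTerm C k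
  term k = begin
    laplaceTerm A k
      ≡⟨ cong (λ a → sgn (toℕ k) * (a * det m (minor A k))) (split k) ⟩
    sgn (toℕ k) * ((B zero k +ℤ C zero k) * det m (minor A k))
      ≡⟨ distrib (sgn (toℕ k)) (B zero k) (C zero k) (det m (minor A k)) ⟩
    sgn (toℕ k) * (B zero k * det m (minor A k)) +ℤ sgn (toℕ k) * (C zero k * det m (minor A k))
      ≡⟨ cong₂ (λ x y → sgn (toℕ k) * (B zero k * x) +ℤ sgn (toℕ k) * (C zero k * y))
           (det-cong m (λ r c → A≈B (λ ()) _)) (det-cong m (λ r c → A≈C (λ ()) _)) ⟩
    laplaceTerm B k +ℤ laplaceTerm C k
      ∎
det-linear (suc m) (suc t) {A} {B} {C} A≈B A≈C split = det-termwise-+ m {A} {B} {C} term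
  where
  distrib : ∀ s a x y → s * (a * (x +ℤ y)) ≡ s * (a * x) +ℤ s * (a * y)
  distrib = solve-∀
  minor-linear : ∀ k → det m (minor A k) ≡ det m (minor B k) +ℤ det m (minor C k)
  minor-linear k = det-linear m t (λ r≢t c → A≈B (r≢t ∘ suc-injective) _)
                                  (λ r≢t c → A≈C (r≢t ∘ suc-injective) _)
                                  (λ c → split (punchIn k c))
  term : ∀ k → laplaceTerm A k ≡ laplaceTerm B k +ℤ laplaceTerm C k
  term k = begin
    laplaceTerm A k
      ≡⟨ cong (λ d → sgn (toℕ k) * (A zero k * d)) (minor-linear k) ⟩
    sgn (toℕ k) * (A zero k * (det m (minor B k) +ℤ det m (minor C k)))
      ≡⟨ distrib (sgn (toℕ k)) (A zero k) (det m (minor B k)) (det m (minor C k)) ⟩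
    sgn (toℕ k) * (A zero k * det m (minor B k)) +ℤ sgn (toℕ k) * (A zero k * det m (minor C k))
      ≡⟨ cong₂ (λ x y → sgn (toℕ k) * (x * det m (minor B k)) +ℤ sgn (toℕ k) * (y * det m (minor C k)))
           (A≈B (λ ()) k) (A≈C (λ ()) k) ⟩
    laplaceTerm B k +ℤ laplaceTerm C k
      ∎

det-equalFirstRows : ∀ m (A : Matrix (suc (suc m))) → (∀ c → A zero c ≡ A (suc zero) c) →
  det (suc (suc m)) A ≡ 0ℤ
det-equalFirstRows m A row₀≡row₁ = begin
  det (suc (suc m)) A                        ≡⟨ det-expand (suc m) A ⟩
  sum (laplaceTerm A)                        ≡⟨ sum-cong-≗ expand-minor ⟩
  sum (λ k → sum (λ l → T k (punchIn k l)))  ≡⟨ ∑-offDiagonal-antisym T T-antisym ⟩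
  0ℤ                                         ∎
  where
  D : Fin (suc (suc m)) → Fin (suc m) → ℤ
  D k l = det m (minor (minor A k) l)

  -- the term of the expansion along rows 0 and 1 that uses columns k and k′
  T : Fin (suc (suc m)) → Fin (suc (suc m)) → ℤ
  T k k′ = (sgn (toℕ k) * sgn (toℕ (punchOut′ k k′)))
         * (A zero k * (A (suc zero) k′ * D k (punchOut′ k k′)))

  reassoc : ∀ s a t x d → s * (a * (t * (x * d))) ≡ (s * t) * (a * (x * d))
  reassoc = solve-∀

  expand-minor : ∀ k → laplaceTerm A k ≡ sum (λ l → T k (punchIn k l))
  expand-minor k = begin
    sgn (toℕ k) * (A zero k * det (suc m) (minor A k))
      ≡⟨ cong (λ d → sgn (toℕ k) * (A zero k * d)) (det-expand m (minor A k)) ⟩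
    sgn (toℕ k) * (A zero k * sum (laplaceTerm (minor A k)))
      ≡⟨ cong (sgn (toℕ k) *_) (*-distribˡ-sum (A zero k) (laplaceTerm (minor A k))) ⟩
    sgn (toℕ k) * sum (λ l → A zero k * laplaceTerm (minor A k) l)
      ≡⟨ *-distribˡ-sum (sgn (toℕ k)) (λ l → A zero k * laplaceTerm (minor A k) l) ⟩
    sum (λ l → sgn (toℕ k) * (A zero k * laplaceTerm (minor A k) l))
      ≡⟨ sum-cong-≗ (λ l → reassoc (sgn (toℕ k)) (A zero k) (sgn (toℕ l))
                                    (A (suc zero) (punchIn k l)) (D k l)) ⟩
    sum (λ l → (sgn (toℕ k) * sgn (toℕ l)) * (A zero k * (A (suc zero) (punchIn k l) * D k l)))
      ≡⟨ sum-cong-≗ (λ l → cong (λ l′ → (sgn (toℕ k) * sgn (toℕ l′))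
                                          * (A zero k * (A (suc zero) (punchIn k l) * D k l′)))
                                 (punchOut′-punchIn k l)) ⟨
    sum (λ l → T k (punchIn k l))
      ∎

  swap : ∀ σ x y d → - σ * (x * (y * d)) ≡ - (σ * (y * (x * d)))
  swap = solve-∀

  T-antisym : ∀ {k k′} → k ≢ k′ → T k′ k ≡ - T k k′
  T-antisym {k} {k′} k≢k′ = begin
    T k′ k
      ≡⟨ cong₂ _*_ (sgn-punchOut′ k≢k′)
           (cong₂ _*_ (row₀≡row₁ k′) (cong₂ _*_ (sym (row₀≡row₁ k)) D-comm)) ⟩
    - σ * (A (suc zero) k′ * (A zero k * D k (punchOut′ k k′)))
      ≡⟨ swap σ (A (suc zero) k′) (A zero k) (D k (punchOut′ k k′)) ⟩
    - T k k′
      ∎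
    where
    σ : ℤ
    σ = sgn (toℕ k) * sgn (toℕ (punchOut′ k k′))
    D-comm : D k′ (punchOut′ k′ k) ≡ D k (punchOut′ k k′)
    D-comm = det-cong m (λ r c → cong (A (suc (suc r))) (sym (punchIn-punchOut′-comm k≢k′ c)))

det-zeroColumn : ∀ m (A : Matrix m) (j : Fin m) → (∀ r → A r j ≡ 0ℤ) → det m A ≡ 0ℤ
det-zeroColumn zero    A () col≡0
det-zeroColumn (suc m) A j  col≡0 = trans (det-expand m A) (sum-zero term≡0)
  where
  term≡0 : ∀ k → laplaceTerm A k ≡ 0ℤ
  term≡0 k with k ≟ j
  ... | yes refl = laplaceTerm-entry≡0 A k (col≡0 zero)
  ... | no k≢j   = laplaceTerm-minor≡0 A k (det-zeroColumn m (minor A k) (punchOut k≢j)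
                     (λ r → trans (cong (A (suc r)) (punchIn-punchOut k≢j)) (col≡0 (suc r))))

Δ : ∀ {m} → Matrix (suc m) → Matrix (suc m)
Δ A zero    c = A zero c
Δ A (suc r) c = A (suc r) c - A (inject₁ r) c

det-Δ : ∀ m (A : Matrix (suc m)) → det (suc m) (Δ A) ≡ det (suc m) A
det-Δ zero    A = refl
det-Δ (suc m) A = begin
  det (suc (suc m)) (Δ A)
    ≡⟨ ℤ.+-identityʳ _ ⟨
  det (suc (suc m)) (Δ A) +ℤ 0ℤ
    ≡⟨ cong (det (suc (suc m)) (Δ A) +ℤ_) (det-equalFirstRows m C (λ _ → refl)) ⟨
  det (suc (suc m)) (Δ A) +ℤ det (suc (suc m)) C
    ≡⟨ det-linear (suc (suc m)) (suc zero) A′≡ΔA A′≡C split ⟨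
  det (suc (suc m)) A′
    ≡⟨ det-cong-minors (suc m) {A′} {A} (λ _ → refl) (λ k → det-Δ m (minor A k)) ⟩
  det (suc (suc m)) A
    ∎
  where
  -- A′ is Δ A except that row 1 keeps A 1 = (A 1 − A 0) + A 0, so its minors are the Δ of
  -- the minors of A; C has two equal first rows.
  A′ C : Matrix (suc (suc m))
  A′ zero          = A zero
  A′ (suc zero)    = A (suc zero)
  A′ (suc (suc r)) = Δ A (suc (suc r))
  C  zero          = A zero
  C  (suc zero)    = A zero
  C  (suc (suc r)) = Δ A (suc (suc r))

  A′≡ΔA : ∀ {r} → r ≢ suc zero → ∀ c → A′ r c ≡ Δ A r c
  A′≡ΔA {zero}        _   c = refl
  A′≡ΔA {suc zero}    1≢1 c = contradiction refl 1≢1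
  A′≡ΔA {suc (suc r)} _   c = refl

  A′≡C : ∀ {r} → r ≢ suc zero → ∀ c → A′ r c ≡ C r c
  A′≡C {zero}        _   c = refl
  A′≡C {suc zero}    1≢1 c = contradiction refl 1≢1
  A′≡C {suc (suc r)} _   c = refl

  split : ∀ c → A′ (suc zero) c ≡ Δ A (suc zero) c +ℤ C (suc zero) c
  split c = telescope (A (suc zero) c) (A zero c)
    where
    telescope : ∀ x y → x ≡ (x - y) +ℤ y
    telescope = solve-∀

det-firstColumnOnes : ∀ m (A : Matrix (suc m)) → (∀ r → A r zero ≡ 1ℤ) →
  det (suc m) A ≡ det m (λ r c → A (suc r) (suc c) - A (inject₁ r) (suc c))
det-firstColumnOnes m A col₀≡1 = begin
  det (suc m) A                                                    ≡⟨ det-Δ m A ⟨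
  det (suc m) (Δ A)                                                ≡⟨ det-expand m (Δ A) ⟩
  laplaceTerm (Δ A) zero +ℤ sum (λ k → laplaceTerm (Δ A) (suc k))  ≡⟨ cong₂ _+ℤ_ pivot (sum-zero others) ⟩
  det m (minor (Δ A) zero) +ℤ 0ℤ                                   ≡⟨ ℤ.+-identityʳ _ ⟩
  det m (minor (Δ A) zero)                                         ∎
  where
  pivot : laplaceTerm (Δ A) zero ≡ det m (minor (Δ A) zero)
  pivot = trans (cong (λ a → 1ℤ * (a * det m (minor (Δ A) zero))) (col₀≡1 zero))
                (trans (ℤ.*-identityˡ _) (ℤ.*-identityˡ _))
  others : ∀ k → laplaceTerm (Δ A) (suc k) ≡ 0ℤ
  others k = laplaceTerm-minor≡0 (Δ A) (suc k) (det-zeroColumn m (minor (Δ A) (suc k)) (punchOut 1+k≢0)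
    (λ r → trans (cong (Δ A (suc r)) (punchIn-punchOut 1+k≢0))
                 (trans (cong₂ _-_ (col₀≡1 (suc r)) (col₀≡1 (inject₁ r))) (ℤ.+-inverseʳ 1ℤ))))
    where
    1+k≢0 : suc k ≢ zero
    1+k≢0 ()

b-pascal : ∀ p q → b (suc p) (suc q) ≡ b p q +ℤ b p (suc q)
b-pascal p q = cong +_ (sym (nCk+nC[k+1]≡[n+1]C[k+1] p q))

b-diff : ∀ p {j} → 0 < j → b (suc p) j - b p j ≡ b p (j ∸ 1)
b-diff p {suc q} _ = trans (cong (_- b p (suc q)) (b-pascal p q)) (cancel (b p q) (b p (suc q)))
  where
  cancel : ∀ x y → (x +ℤ y) - y ≡ x
  cancel = solve-∀

b-diff₂ : ∀ p {j} → 0 < j → b (suc (suc p)) j - b p j ≡ b p (j ∸ 1) +ℤ b (suc p) (j ∸ 1)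
b-diff₂ p {j} 0<j = begin
  b (suc (suc p)) j - b p j                                 ≡⟨ telescope (b (suc (suc p)) j) (b (suc p) j) (b p j) ⟩
  (b (suc p) j - b p j) +ℤ (b (suc (suc p)) j - b (suc p) j) ≡⟨ cong₂ _+ℤ_ (b-diff p 0<j) (b-diff (suc p) 0<j) ⟩
  b p (j ∸ 1) +ℤ b (suc p) (j ∸ 1)                          ∎
  where
  telescope : ∀ x y z → x - z ≡ (y - z) +ℤ (x - y)
  telescope = solve-∀

bMinor-0∷ : ∀ {n} (I : Vec ℕ (suc (suc n))) (js : Vec ℕ (suc n)) →
  bMinor I (0 ∷ js)
    ≡ det (suc n) (λ a c → b (lookup I (suc a)) (lookup js c) - b (lookup I (inject₁ a)) (lookup js c))
bMinor-0∷ {n} I js = det-firstColumnOnes (suc n) (λ r s → b (lookup I r) (lookup (0 ∷ js) s)) (λ _ → refl)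

lookup-interval : ∀ i m (a : Fin m) → lookup (interval i m) a ≡ i + toℕ a
lookup-interval i m = lookup∘tabulate (λ k → i + toℕ k)

bMinor-interval-0∷ : ∀ i {n} (js : Vec ℕ (suc n)) → (∀ c → 0 < lookup js c) →
  bMinor (interval i (2 + n)) (0 ∷ js) ≡ bMinor (interval i (1 + n)) (map (_∸ 1) js)
bMinor-interval-0∷ i {n} js js>0 = trans (bMinor-0∷ I js) (det-cong (suc n) entry)
  where
  I : Vec ℕ (2 + n)
  I = interval i (2 + n)

  j : Fin (suc n) → ℕ
  j = lookup js

  entry : ∀ a c → b (lookup I (suc a)) (j c) - b (lookup I (inject₁ a)) (j c)
                ≡ b (lookup (interval i (1 + n)) a) (lookup (map (_∸ 1) js) c)
  entry a c = begin
    b (lookup I (suc a)) (j c) - b (lookup I (inject₁ a)) (j c)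
      ≡⟨ cong₂ (λ p p′ → b p (j c) - b p′ (j c))
           (trans (lookup-interval i _ (suc a)) (ℕ.+-suc i (toℕ a)))
           (trans (lookup-interval i _ (inject₁ a)) (cong (λ x → i + x) (toℕ-inject₁ a))) ⟩
    b (suc (i + toℕ a)) (j c) - b (i + toℕ a) (j c)
      ≡⟨ b-diff (i + toℕ a) (js>0 c) ⟩
    b (i + toℕ a) (j c ∸ 1)
      ≡⟨ cong₂ b (lookup-interval i _ a) (lookup-map c (_∸ 1) js) ⟨
    b (lookup (interval i (1 + n)) a) (lookup (map (_∸ 1) js) c)
      ∎

intervalWithoutAt : ℕ → ℕ → ℕ → ℕ
intervalWithoutAt i r x = if suc x <ᵇ r then i + x else i + suc x

lookup-intervalWithout : ∀ i m r (a : Fin m) →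
  lookup (intervalWithout i m r) a ≡ intervalWithoutAt i r (toℕ a)
lookup-intervalWithout i m r = lookup∘tabulate (λ k → intervalWithoutAt i r (toℕ k))

intervalWithoutAt-< : ∀ i {r x} → suc x < r → intervalWithoutAt i r x ≡ i + x
intervalWithoutAt-< i {r} {x} 1+x<r with suc x <ᵇ r | ℕ.<⇒<ᵇ 1+x<r
... | true | _ = refl

intervalWithoutAt-≥ : ∀ i {r x} → r ≤ suc x → intervalWithoutAt i r x ≡ i + suc x
intervalWithoutAt-≥ i {r} {x} r≤1+x with suc x <ᵇ r | ℕ.<ᵇ⇒< (suc x) r
... | true  | 1+x<r = contradiction (1+x<r tt) (ℕ.≤⇒≯ r≤1+x)
... | false | _     = refl

intervalWithoutAt-suc : ∀ i {r x} → suc (suc x) ≢ r →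
  intervalWithoutAt i r (suc x) ≡ suc (intervalWithoutAt i r x)
intervalWithoutAt-suc i {r} {x} 2+x≢r with ℕ.<-cmp (suc (suc x)) r
... | tri< 2+x<r _ _ = trans (intervalWithoutAt-< i 2+x<r)
                             (trans (ℕ.+-suc i x) (cong suc (sym (intervalWithoutAt-< i (ℕ.<⇒≤ 2+x<r)))))
... | tri≈ _ 2+x≡r _ = contradiction 2+x≡r 2+x≢r
... | tri> _ _ r<2+x = trans (intervalWithoutAt-≥ i (ℕ.<⇒≤ r<2+x))
                             (trans (ℕ.+-suc i (suc x)) (cong suc (sym (intervalWithoutAt-≥ i (s≤s⁻¹ r<2+x)))))

intervalWithoutAt-shift : ∀ i {r x} → suc x ≢ r →
  intervalWithoutAt i (suc r) x ≡ intervalWithoutAt i r x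
intervalWithoutAt-shift i {r} {x} 1+x≢r with ℕ.<-cmp (suc x) r
... | tri< 1+x<r _ _ = trans (intervalWithoutAt-< i (ℕ.m<n⇒m<1+n 1+x<r)) (sym (intervalWithoutAt-< i 1+x<r))
... | tri≈ _ 1+x≡r _ = contradiction 1+x≡r 1+x≢r
... | tri> _ _ r<1+x = trans (intervalWithoutAt-≥ i r<1+x) (sym (intervalWithoutAt-≥ i (ℕ.<⇒≤ r<1+x)))

intervalWithoutAt-gap : ∀ i x →
  intervalWithoutAt i (2 + x) (suc x) ≡ suc (suc (intervalWithoutAt i (2 + x) x))
intervalWithoutAt-gap i x = begin
  intervalWithoutAt i (2 + x) (suc x)         ≡⟨ intervalWithoutAt-≥ i ℕ.≤-refl ⟩
  i + suc (suc x)                             ≡⟨ ℕ.+-suc i (suc x) ⟩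
  suc (i + suc x)                             ≡⟨ cong suc (ℕ.+-suc i x) ⟩
  suc (suc (i + x))                           ≡⟨ cong (λ y → suc (suc y)) (intervalWithoutAt-< i {2 + x} ℕ.≤-refl) ⟨
  suc (suc (intervalWithoutAt i (2 + x) x))   ∎

intervalWithoutAt-removed : ∀ i x →
  intervalWithoutAt i (1 + x) x ≡ suc (intervalWithoutAt i (2 + x) x)
intervalWithoutAt-removed i x = begin
  intervalWithoutAt i (1 + x) x         ≡⟨ intervalWithoutAt-≥ i ℕ.≤-refl ⟩
  i + suc x                             ≡⟨ ℕ.+-suc i x ⟩
  suc (i + x)                           ≡⟨ cong suc (intervalWithoutAt-< i {2 + x} ℕ.≤-refl) ⟨
  suc (intervalWithoutAt i (2 + x) x)   ∎

intervalWithout-first : ∀ i m → intervalWithout i m 1 ≡ interval (suc i) m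
intervalWithout-first i m = tabulate-cong (λ k → trans (intervalWithoutAt-≥ i (s≤s z≤n)) (ℕ.+-suc i (toℕ k)))

intervalWithout-last : ∀ i m → intervalWithout i m (suc m) ≡ interval i m
intervalWithout-last i m = tabulate-cong (λ k → intervalWithoutAt-< i (s≤s (toℕ<n k)))

bMinor-intervalWithout-0∷ : ∀ i {n} q → q ≤ n → (js : Vec ℕ (suc n)) → (∀ c → 0 < lookup js c) →
  bMinor (intervalWithout i (2 + n) (2 + q)) (0 ∷ js)
    ≡ bMinor (intervalWithout i (1 + n) (2 + q)) (map (_∸ 1) js)
      +ℤ bMinor (intervalWithout i (1 + n) (1 + q)) (map (_∸ 1) js)
bMinor-intervalWithout-0∷ i {n} q q≤n js js>0 =
  trans (bMinor-0∷ I js) (det-linear (suc n) t {D} {E (2 + q)} {E (1 + q)} offRow₁ offRow₂ onRow)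
  where
  I : Vec ℕ (2 + n)
  I = intervalWithout i (2 + n) (2 + q)

  at : ℕ → ℕ → ℕ
  at = intervalWithoutAt i

  j : Fin (suc n) → ℕ
  j = lookup js

  D : Matrix (suc n)
  D a c = b (lookup I (suc a)) (j c) - b (lookup I (inject₁ a)) (j c)

  E : ℕ → Matrix (suc n)
  E r a c = b (lookup (intervalWithout i (1 + n) r) a) (lookup (map (_∸ 1) js) c)

  t : Fin (suc n)
  t = fromℕ< (s≤s q≤n)

  toℕt≡q : toℕ t ≡ q
  toℕt≡q = toℕ-fromℕ< (s≤s q≤n)

  toℕ≢q : ∀ {a} → a ≢ t → toℕ a ≢ q
  toℕ≢q a≢t x≡q = a≢t (toℕ-injective (trans x≡q (sym toℕt≡q)))

  E-entry : ∀ r a c → E r a c ≡ b (at r (toℕ a)) (j c ∸ 1)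
  E-entry r a c = cong₂ b (lookup-intervalWithout i _ r a) (lookup-map c (_∸ 1) js)

  D-entry : ∀ a c → D a c ≡ b (at (2 + q) (suc (toℕ a))) (j c) - b (at (2 + q) (toℕ a)) (j c)
  D-entry a c = cong₂ (λ p p′ → b p (j c) - b p′ (j c))
    (lookup-intervalWithout i _ (2 + q) (suc a))
    (trans (lookup-intervalWithout i _ (2 + q) (inject₁ a)) (cong (at (2 + q)) (toℕ-inject₁ a)))

  offRow : ∀ {a} → a ≢ t → ∀ c → D a c ≡ b (at (2 + q) (toℕ a)) (j c ∸ 1)
  offRow {a} a≢t c = begin
    D a c
      ≡⟨ D-entry a c ⟩
    b (at (2 + q) (suc (toℕ a))) (j c) - b (at (2 + q) (toℕ a)) (j c)
      ≡⟨ cong (λ p → b p (j c) - b (at (2 + q) (toℕ a)) (j c))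
              (intervalWithoutAt-suc i (toℕ≢q a≢t ∘ ℕ.suc-injective ∘ ℕ.suc-injective)) ⟩
    b (suc (at (2 + q) (toℕ a))) (j c) - b (at (2 + q) (toℕ a)) (j c)
      ≡⟨ b-diff _ (js>0 c) ⟩
    b (at (2 + q) (toℕ a)) (j c ∸ 1)
      ∎

  offRow₁ : ∀ {a} → a ≢ t → ∀ c → D a c ≡ E (2 + q) a c
  offRow₁ {a} a≢t c = trans (offRow a≢t c) (sym (E-entry (2 + q) a c))

  offRow₂ : ∀ {a} → a ≢ t → ∀ c → D a c ≡ E (1 + q) a c
  offRow₂ {a} a≢t c = begin
    D a c                              ≡⟨ offRow a≢t c ⟩
    b (at (2 + q) (toℕ a)) (j c ∸ 1)   ≡⟨ cong (λ p → b p (j c ∸ 1)) (intervalWithoutAt-shift i (toℕ≢q a≢t ∘ ℕ.suc-injective)) ⟩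
    b (at (1 + q) (toℕ a)) (j c ∸ 1)   ≡⟨ E-entry (1 + q) a c ⟨
    E (1 + q) a c                      ∎

  onRow : ∀ c → D t c ≡ E (2 + q) t c +ℤ E (1 + q) t c
  onRow c = begin
    D t c
      ≡⟨ D-entry t c ⟩
    b (at (2 + q) (suc (toℕ t))) (j c) - b (at (2 + q) (toℕ t)) (j c)
      ≡⟨ cong (λ x → b (at (2 + q) (suc x)) (j c) - b (at (2 + q) x) (j c)) toℕt≡q ⟩
    b (at (2 + q) (suc q)) (j c) - b (at (2 + q) q) (j c)
      ≡⟨ cong (λ p → b p (j c) - b (at (2 + q) q) (j c)) (intervalWithoutAt-gap i q) ⟩
    b (suc (suc (at (2 + q) q))) (j c) - b (at (2 + q) q) (j c)
      ≡⟨ b-diff₂ _ (js>0 c) ⟩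
    b (at (2 + q) q) (j c ∸ 1) +ℤ b (suc (at (2 + q) q)) (j c ∸ 1)
      ≡⟨ cong (λ p → b (at (2 + q) q) (j c ∸ 1) +ℤ b p (j c ∸ 1)) (intervalWithoutAt-removed i q) ⟨
    b (at (2 + q) q) (j c ∸ 1) +ℤ b (at (1 + q) q) (j c ∸ 1)
      ≡⟨ cong (λ x → b (at (2 + q) x) (j c ∸ 1) +ℤ b (at (1 + q) x) (j c ∸ 1)) toℕt≡q ⟨
    b (at (2 + q) (toℕ t)) (j c ∸ 1) +ℤ b (at (1 + q) (toℕ t)) (j c ∸ 1)
      ≡⟨ cong₂ _+ℤ_ (E-entry (2 + q) t c) (E-entry (1 + q) t c) ⟨
    E (2 + q) t c +ℤ E (1 + q) t c
      ∎

lemma6p1 : (n i : ℕ) → (js : Vec ℕ (suc n)) →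
    StrictlyIncreasing (0 ∷ js) →
    (0 ∷ js) ≼ intervalWithout i (2 + n) (3 + n) →
    ((r : ℕ) → 2 ≤ r → r ≤ 2 + n →
      bMinor (intervalWithout i (2 + n) r) (0 ∷ js)
        ≡ bMinor (intervalWithout i (1 + n) r) (map (_∸ 1) js)
          +ℤ bMinor (intervalWithout i (1 + n) (r ∸ 1)) (map (_∸ 1) js))
    × (bMinor (intervalWithout i (2 + n) 1) (0 ∷ js) ≡ bMinor (interval (suc i) (suc n)) (map (_∸ 1) js))
    × (bMinor (intervalWithout i (2 + n) (3 + n)) (0 ∷ js) ≡ bMinor (interval i (suc n)) (map (_∸ 1) js))
lemma6p1 n i js increasing _ = middle , first , last
  where
  js>0 : ∀ c → 0 < lookup js c
  js>0 c = increasing zero (suc c) (s≤s z≤n)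

  middle : (r : ℕ) → 2 ≤ r → r ≤ 2 + n →
    bMinor (intervalWithout i (2 + n) r) (0 ∷ js)
      ≡ bMinor (intervalWithout i (1 + n) r) (map (_∸ 1) js)
        +ℤ bMinor (intervalWithout i (1 + n) (r ∸ 1)) (map (_∸ 1) js)
  middle (suc zero)    (s≤s ()) _
  middle (suc (suc q)) _        (s≤s (s≤s q≤n)) = bMinor-intervalWithout-0∷ i q q≤n js js>0

  first : bMinor (intervalWithout i (2 + n) 1) (0 ∷ js) ≡ bMinor (interval (suc i) (suc n)) (map (_∸ 1) js)
  first = trans (cong (λ I → bMinor I (0 ∷ js)) (intervalWithout-first i (2 + n)))
                (bMinor-interval-0∷ (suc i) js js>0)

  last : bMinor (intervalWithout i (2 + n) (3 + n)) (0 ∷ js) ≡ bMinor (interval i (suc n)) (map (_∸ 1) js)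
  last = trans (cong (λ I → bMinor I (0 ∷ js)) (intervalWithout-last i (2 + n)))
               (bMinor-interval-0∷ i js js>0)
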